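{- Let $D$ be a digraph and let $P_{uv}$ be a directed path from vertex $u$ to vertex $v$ in $D$. Then for all vertices $u',v'$ we have $\lambda_{D^{P_{uv}}}(u',v')\ge\min(\lambda_D(u,v)-1,\lambda_D(u',v'))$. Furthermore, $\lambda_{D^{P_{uv}}}(u,v)=\lambda_D(u,v)-1$.
   Context: $\lambda_D(x,y)$ denotes the maximum number of pairwise arc-disjoint directed paths from $x$ to $y$ in $D$. $D^{P}$ denotes the digraph obtained from $D$ by reversing all arcs of $P$. Digraphs may have parallel arcs. -}

module Defs where

open import Data.Nat using (ℕ; suc)
open import Data.Fin using (Fin; _≟_)
open import Data.List using (List; []; _∷_; map)
open import Data.List.Membership.Propositional using (_∈_)
open import Data.List.Relation.Unary.Unique.Propositional using (Unique)
open import Data.Product using (Σ; _×_)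
open import Data.Empty using (⊥)
open import Relation.Binary.PropositionalEquality using (_≡_)
open import Relation.Nullary using (¬_; yes; no)
import Data.List.Membership.DecPropositional as DecMem

-- A finite digraph on vertex set Fin n, with arcs Fin (nArcs D);
-- parallel arcs (and loops) are allowed since tail/head are arbitrary functions.
record Digraph (n : ℕ) : Set where
  field
    nArcs : ℕ
    tail  : Fin nArcs → Fin n
    head  : Fin nArcs → Fin n
open Digraph public

Arc : ∀ {n} → Digraph n → Set
Arc D = Fin (nArcs D)

data IsWalk {n} (D : Digraph n) : Fin n → Fin n → List (Arc D) → Set where
  nil  : ∀ {x} → IsWalk D x x []
  cons : ∀ {x y a as} → tail D a ≡ x → IsWalk D (head D a) y as → IsWalk D x y (a ∷ as)

IsPath : ∀ {n} (D : Digraph n) → Fin n → Fin n → List (Arc D) → Set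
IsPath D x y as = IsWalk D x y as × Unique (x ∷ map (head D) as)

ArcDisjoint : ∀ {n} {D : Digraph n} → List (Arc D) → List (Arc D) → Set
ArcDisjoint p q = ∀ a → a ∈ p → a ∈ q → ⊥

HasDisjointPaths : ∀ {n} (D : Digraph n) → Fin n → Fin n → ℕ → Set
HasDisjointPaths D x y k =
  Σ (Fin k → List (Arc D)) λ ps →
    (∀ i → IsPath D x y (ps i)) × (∀ i j → ¬ i ≡ j → ArcDisjoint {D = D} (ps i) (ps j))

IsLambda : ∀ {n} (D : Digraph n) → Fin n → Fin n → ℕ → Set
IsLambda D x y k = HasDisjointPaths D x y k × ¬ HasDisjointPaths D x y (suc k)

reverseArcs : ∀ {n} (D : Digraph n) → List (Arc D) → Digraph n
reverseArcs D P = record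
  { nArcs = nArcs D
  ; tail  = λ a → sel a (head D a) (tail D a)
  ; head  = λ a → sel a (tail D a) (head D a)
  }
  where
    open DecMem (_≟_ {n = nArcs D}) using (_∈?_)
    sel : ∀ {A : Set} → Arc D → A → A → A
    sel a onP offP with a ∈? P
    ... | yes _ = onP
    ... | no  _ = offP

module Submission where

-- The proof goes through Menger's theorem for arc-disjoint paths, phrased with
-- 0/1 flows.  An arc set F is an s–t flow of value k when for every vertex set
-- X the arcs of F leaving X and entering X differ by k in the direction
-- prescribed by the positions of s and t (unit capacities, conservation stated
-- on all cuts at once).  The theorem is then the shift identity for the reversed path P:
-- cuts separating u from v lose one arc, the others lose none.

open import Defs
open import Data.Nat using (ℕ; zero; suc; _+_; _∸_; _⊓_; _≤_; _<_; z≤n)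
open import Data.Nat.Properties
  using ( +-comm; +-identityʳ; +-cancelˡ-≡; +-cancelʳ-≡; +-mono-≤; +-mono-<-≤; +-mono-≤-<
        ; ≤-refl; ≤-reflexive; ≤-trans; ≤-antisym; <-≤-trans; ≤-pred; m≤n+m; m≤m+n; m∸n≤m
        ; ∸-monoˡ-≤; m⊓n≤m; m⊓n≤n; m≤n⇒m⊓n≡m; +-*-semiring; +-commutativeSemigroup )
open import Data.Nat.Tactic.RingSolver using (solve-∀)
open import Data.Bool using (Bool; true; false; not; _∧_; _∨_; _xor_; if_then_else_)
open import Data.Bool.Properties using (¬-not; ∧-identityʳ) renaming (_≟_ to _≟ᵇ_)
open import Data.Fin using (Fin; zero; suc; _≟_)
open import Data.Fin.Properties using (any?; suc-injective)
open import Data.List using (List; []; _∷_; map)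
open import Data.List.Membership.Propositional using (_∈_)
open import Data.List.Membership.Propositional.Properties using (∈-map⁺)
open import Data.List.Relation.Unary.All as All using (All; []; _∷_)
open import Data.List.Relation.Unary.AllPairs using ([]; _∷_)
open import Data.List.Relation.Unary.Unique.Propositional using (Unique)
import Data.List.Membership.DecPropositional as DecMembership
open import Data.Product using (Σ-syntax; ∃; ∃-syntax; _×_; _,_; proj₁; proj₂)
open import Data.Sum using (_⊎_; inj₁; inj₂)
open import Data.Empty using (⊥-elim)
open import Function using (_∘_)
open import Function.Bundles using (_⇔_; mk⇔; Equivalence)
open import Relation.Nullary using (¬_; Dec; yes; no; does)
open import Relation.Nullary.Decidable using (_×-dec_; dec-true; dec-false)
open import Relation.Binary.PropositionalEquality
  using (_≡_; refl; sym; trans; cong; cong₂; subst; module ≡-Reasoning)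
open import Algebra.Properties.Semiring.Sum +-*-semiring
  using (sum; ∑-distrib-+; sum-cong-≗; sum-replicate-zero)
open import Algebra.Properties.CommutativeSemigroup +-commutativeSemigroup using (interchange; x∙yz≈y∙xz)

open ≡-Reasoning

infix 8 _when_
_when_ : ℕ → Bool → ℕ
k when true  = k
k when false = 0

𝟙 : Bool → ℕ
𝟙 b = 1 when b

when-distrib : ∀ j k b → (j + k) when b ≡ j when b + k when b
when-distrib j k true  = refl
when-distrib j k false = refl

0-when : ∀ b → 0 when b ≡ 0
0-when true  = refl
0-when false = refl

-- Equations of the form a + b ≡ c + d ("a - c = d - b") can be added,
-- subtracted, chained and transferred, as for integers.
balance-+ : ∀ a b c d a′ b′ c′ d′ → a + b ≡ c + d → a′ + b′ ≡ c′ + d′ →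
            (a + a′) + (b + b′) ≡ (c + c′) + (d + d′)
balance-+ a b c d a′ b′ c′ d′ e e′ = begin
  (a + a′) + (b + b′) ≡⟨ interchange a a′ b b′ ⟩
  (a + b) + (a′ + b′) ≡⟨ cong₂ _+_ e e′ ⟩
  (c + d) + (c′ + d′) ≡⟨ interchange c d c′ d′ ⟩
  (c + c′) + (d + d′) ∎

balance-∸ : ∀ a b c d a′ b′ c′ d′ → a + b ≡ c + d →
            (a + a′) + (b + b′) ≡ (c + c′) + (d + d′) → a′ + b′ ≡ c′ + d′
balance-∸ a b c d a′ b′ c′ d′ e e″ = +-cancelˡ-≡ (c + d) _ _ (begin
  (c + d) + (a′ + b′) ≡⟨ cong (_+ (a′ + b′)) (sym e) ⟩
  (a + b) + (a′ + b′) ≡⟨ interchange a b a′ b′ ⟩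
  (a + a′) + (b + b′) ≡⟨ e″ ⟩
  (c + c′) + (d + d′) ≡⟨ interchange c c′ d d′ ⟩
  (c + d) + (c′ + d′) ∎)

balance-chain : ∀ a c d a′ b′ c′ x → a + x ≡ c + d → a′ + b′ ≡ c′ + x →
                (a + a′) + b′ ≡ (c + c′) + d
balance-chain a c d a′ b′ c′ x e e′ = +-cancelʳ-≡ x _ _ (begin
  ((a + a′) + b′) + x ≡⟨ shuffle a a′ b′ x ⟩
  (a + x) + (a′ + b′) ≡⟨ cong₂ _+_ e e′ ⟩
  (c + d) + (c′ + x)  ≡⟨ shuffle′ c d c′ x ⟩
  ((c + c′) + d) + x  ∎)
  where
  shuffle : ∀ a a′ b′ x → ((a + a′) + b′) + x ≡ (a + x) + (a′ + b′)
  shuffle = solve-∀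
  shuffle′ : ∀ c d c′ x → (c + d) + (c′ + x) ≡ ((c + c′) + d) + x
  shuffle′ = solve-∀

balance-transfer : ∀ a c x y p q → a + x ≡ c + y → x + p ≡ y + q → a + q ≡ c + p
balance-transfer a c x y p q e e′ = +-cancelʳ-≡ (x + y) _ _ (begin
  (a + q) + (x + y) ≡⟨ shuffle a q x y ⟩
  (a + x) + (y + q) ≡⟨ cong₂ _+_ e (sym e′) ⟩
  (c + y) + (x + p) ≡⟨ shuffle′ c y x p ⟩
  (c + p) + (x + y) ∎)
  where
  shuffle : ∀ a q x y → (a + q) + (x + y) ≡ (a + x) + (y + q)
  shuffle = solve-∀
  shuffle′ : ∀ c y x p → (c + y) + (x + p) ≡ (c + p) + (x + y)
  shuffle′ = solve-∀

∑-balance : ∀ {m} (f g h k : Fin m → ℕ) → (∀ i → f i + g i ≡ h i + k i) →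
            sum f + sum g ≡ sum h + sum k
∑-balance f g h k e = begin
  sum f + sum g         ≡⟨ sym (∑-distrib-+ f g) ⟩
  sum (λ i → f i + g i) ≡⟨ sum-cong-≗ e ⟩
  sum (λ i → h i + k i) ≡⟨ ∑-distrib-+ h k ⟩
  sum h + sum k         ∎

∑-zero : ∀ {m} (f : Fin m → ℕ) → (∀ i → f i ≡ 0) → sum f ≡ 0
∑-zero {m} f e = trans (sum-cong-≗ e) (sum-replicate-zero m)

∑-mono : ∀ {m} {f g : Fin m → ℕ} → (∀ i → f i ≤ g i) → sum f ≤ sum g
∑-mono {zero}  _  = z≤n
∑-mono {suc m} le = +-mono-≤ (le zero) (∑-mono (le ∘ suc))

∑-mono-< : ∀ {m} {f g : Fin m → ℕ} (i : Fin m) → (∀ j → f j ≤ g j) → f i < g i →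
           sum f < sum g
∑-mono-< zero    le lt = +-mono-<-≤ lt (∑-mono (le ∘ suc))
∑-mono-< (suc i) le lt = +-mono-≤-< (le zero) (∑-mono-< i (le ∘ suc) lt)

Subset : ℕ → Set
Subset m = Fin m → Bool

module _ {m : ℕ} where

  ∅ full : Subset m
  ∅ _    = false
  full _ = true

  ⁅_⁆ : Fin m → Subset m
  ⁅ a ⁆ b = does (b ≟ a)

  _∈?_ : (a : Fin m) (p : List (Fin m)) → Dec (a ∈ p)
  a ∈? p = DecMembership._∈?_ _≟_ a p

  ⟨_⟩ : List (Fin m) → Subset m
  ⟨ p ⟩ a = does (a ∈? p)

  infixr 7 _∩_
  infixr 6 _∪_ _∖_ _⊕_
  _∩_ _∪_ _∖_ _⊕_ : Subset m → Subset m → Subset m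
  (S ∩ T) x = S x ∧ T x
  (S ∪ T) x = S x ∨ T x
  (S ∖ T) x = S x ∧ not (T x)
  (S ⊕ T) x = S x xor T x

  ∁ : Subset m → Subset m
  ∁ S = not ∘ S

  ⋃ : ∀ {k} → (Fin k → Subset m) → Subset m
  ⋃ {zero}  S = ∅
  ⋃ {suc k} S = S zero ∪ ⋃ (S ∘ suc)

  ∣_∣ : Subset m → ℕ
  ∣ S ∣ = sum (𝟙 ∘ S)

  record IsDisjointUnion (S S₁ S₂ : Subset m) : Set where
    constructor disjointUnion
    field
      count-split : ∀ x → 𝟙 (S x) ≡ 𝟙 (S₁ x) + 𝟙 (S₂ x)
  open IsDisjointUnion public

  ⁅⁆-elim : ∀ {a b} → ⁅ a ⁆ b ≡ true → b ≡ a
  ⁅⁆-elim {a} {b} e with b ≟ a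
  ⁅⁆-elim e  | yes b≡a = b≡a
  ⁅⁆-elim () | no _

  ⟨⟩-elim : ∀ {a p} → ⟨ p ⟩ a ≡ true → a ∈ p
  ⟨⟩-elim {a} {p} e with a ∈? p
  ⟨⟩-elim e  | yes a∈p = a∈p
  ⟨⟩-elim () | no _

  ∖-elim : ∀ S T {x} → (S ∖ T) x ≡ true → S x ≡ true × T x ≡ false
  ∖-elim S T {x} e with S x | T x
  ∖-elim S T e | true | false = refl , refl

  ∪-introˡ : ∀ S T {x} → S x ≡ true → (S ∪ T) x ≡ true
  ∪-introˡ S T Sx rewrite Sx = refl

  ∪-introʳ : ∀ S T {x} → T x ≡ true → (S ∪ T) x ≡ true
  ∪-introʳ S T {x} Tx with S x
  ... | true  = refl
  ... | false = Tx

  ⋃-elim : ∀ {k} (S : Fin k → Subset m) x → ⋃ S x ≡ true → ∃[ j ] S j x ≡ true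
  ⋃-elim {suc k} S x e with S zero x in e₀
  ... | true  = zero , e₀
  ... | false = let (j , eⱼ) = ⋃-elim (S ∘ suc) x e in suc j , eⱼ

  ∣∣-disjointUnion : ∀ {S S₁ S₂} → IsDisjointUnion S S₁ S₂ → ∣ S ∣ ≡ ∣ S₁ ∣ + ∣ S₂ ∣
  ∣∣-disjointUnion {S} {S₁} {S₂} (disjointUnion split) = trans (sum-cong-≗ split) (∑-distrib-+ (𝟙 ∘ S₁) (𝟙 ∘ S₂))

  disjointUnion-∩ : ∀ {S S₁ S₂} → IsDisjointUnion S S₁ S₂ → ∀ T → IsDisjointUnion (S ∩ T) (S₁ ∩ T) (S₂ ∩ T)
  disjointUnion-∩ {S} {S₁} {S₂} (disjointUnion split) T .count-split x = restrict (S x) (S₁ x) (S₂ x) (split x)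
    where
    restrict : ∀ y y₁ y₂ → 𝟙 y ≡ 𝟙 y₁ + 𝟙 y₂ → 𝟙 (y ∧ T x) ≡ 𝟙 (y₁ ∧ T x) + 𝟙 (y₂ ∧ T x)
    restrict true  true  false _ = sym (+-identityʳ _)
    restrict true  false true  _ = refl
    restrict false false false _ = refl
    restrict true  true  true  ()
    restrict true  false false ()
    restrict false true  _     ()
    restrict false false true  ()

  disjointUnion-∪ : ∀ {S₁ S₂} → (∀ x → S₁ x ≡ true → S₂ x ≡ false) → IsDisjointUnion (S₁ ∪ S₂) S₁ S₂
  disjointUnion-∪ {S₁} {S₂} disjoint .count-split x with S₁ x in e
  ... | true  = cong (λ b → 1 + 𝟙 b) (sym (disjoint x e))
  ... | false = refl

  disjointUnion-∖ : ∀ {S T} → (∀ x → T x ≡ true → S x ≡ true) → IsDisjointUnion S T (S ∖ T)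
  disjointUnion-∖ {S} {T} T⊆S .count-split x with T x in e
  ... | true  rewrite T⊆S x e = refl
  ... | false = cong 𝟙 (sym (∧-identityʳ (S x)))

  ∣∩∣≤ : ∀ S T → ∣ S ∩ T ∣ ≤ ∣ T ∣
  ∣∩∣≤ S T = ∑-mono (λ x → bound (S x) (T x))
    where
    bound : ∀ y z → 𝟙 (y ∧ z) ≤ 𝟙 z
    bound true  _ = ≤-refl
    bound false _ = z≤n

  ∣∁∪∣< : ∀ R T {x} → R x ≡ false → T x ≡ true → ∣ ∁ (R ∪ T) ∣ < ∣ ∁ R ∣
  ∣∁∪∣< R T {x} Rx Tx = ∑-mono-< x (λ y → bound (R y) (T y)) strict
    where
    bound : ∀ r t → 𝟙 (not (r ∨ t)) ≤ 𝟙 (not r)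
    bound true  _     = z≤n
    bound false true  = z≤n
    bound false false = ≤-refl
    strict : 𝟙 (not (R x ∨ T x)) < 𝟙 (not (R x))
    strict rewrite Rx | Tx = ≤-refl

∣⁅⁆∩∣ : ∀ {m} (a : Fin m) (T : Subset m) → ∣ ⁅ a ⁆ ∩ T ∣ ≡ 𝟙 (T a)
∣⁅⁆∩∣ {suc m} zero T = begin
  ∣ ⁅ zero ⁆ ∩ T ∣             ≡⟨⟩
  𝟙 (T zero) + sum {m} (λ _ → 0) ≡⟨ cong (𝟙 (T zero) +_) (∑-zero {m} (λ _ → 0) (λ _ → refl)) ⟩
  𝟙 (T zero) + 0               ≡⟨ +-identityʳ (𝟙 (T zero)) ⟩
  𝟙 (T zero)                   ∎
∣⁅⁆∩∣ (suc a) T = ∣⁅⁆∩∣ a (T ∘ suc)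

ArcSet : ∀ {n} → Digraph n → Set
ArcSet G = Subset (nArcs G)

leaving entering : ∀ {n} (G : Digraph n) → Subset n → ArcSet G
leaving  G X a = X (tail G a) ∧ not (X (head G a))
entering G X a = X (head G a) ∧ not (X (tail G a))

cut : ∀ {n} (G : Digraph n) → Subset n → ℕ
cut G X = ∣ leaving G X ∣

-- F is an s–t flow of value k: on every cut, the arcs of F leaving X exceed
-- those entering X by k if X separates s from t, and by -k if X separates t
-- from s (with unit capacities this is flow conservation at every vertex).
record IsFlow {n} (G : Digraph n) (F : ArcSet G) (s t : Fin n) (k : ℕ) : Set where
  constructor mkFlow
  field
    cut-balance : ∀ X → ∣ F ∩ leaving G X ∣ + k when X t ≡ ∣ F ∩ entering G X ∣ + k when X s
open IsFlow public

-- G with the arcs of F reversed (the residual graph of the flow F).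
reverseArcSet : ∀ {n} (G : Digraph n) → ArcSet G → Digraph n
reverseArcSet G F = record
  { nArcs = nArcs G
  ; tail  = λ a → if F a then head G a else tail G a
  ; head  = λ a → if F a then tail G a else head G a
  }

module _ {n : ℕ} (G : Digraph n) where

  flow-disjointUnion : ∀ {F F₁ F₂ s t k₁ k₂} → IsDisjointUnion F F₁ F₂ → IsFlow G F₁ s t k₁ →
                       IsFlow G F₂ s t k₂ ⇔ IsFlow G F s t (k₁ + k₂)
  flow-disjointUnion {F} {F₁} {F₂} {s} {t} {k₁} {k₂} split flow₁ = mk⇔
    (λ flow₂ → mkFlow λ X → trans (split-out X) (trans (add X flow₂) (sym (split-in X))))
    (λ flow  → mkFlow λ X → subtract X (trans (sym (split-out X)) (trans (cut-balance flow X) (split-in X))))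
    where
    o₁ o₂ i₁ i₂ : Subset n → ℕ
    o₁ X = ∣ F₁ ∩ leaving G X ∣
    o₂ X = ∣ F₂ ∩ leaving G X ∣
    i₁ X = ∣ F₁ ∩ entering G X ∣
    i₂ X = ∣ F₂ ∩ entering G X ∣
    split-out : ∀ X → ∣ F ∩ leaving G X ∣ + (k₁ + k₂) when X t ≡ (o₁ X + o₂ X) + (k₁ when X t + k₂ when X t)
    split-out X = cong₂ _+_ (∣∣-disjointUnion (disjointUnion-∩ split (leaving G X))) (when-distrib k₁ k₂ (X t))
    split-in : ∀ X → ∣ F ∩ entering G X ∣ + (k₁ + k₂) when X s ≡ (i₁ X + i₂ X) + (k₁ when X s + k₂ when X s)
    split-in X = cong₂ _+_ (∣∣-disjointUnion (disjointUnion-∩ split (entering G X))) (when-distrib k₁ k₂ (X s))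
    add : ∀ X → IsFlow G F₂ s t k₂ →
          (o₁ X + o₂ X) + (k₁ when X t + k₂ when X t) ≡ (i₁ X + i₂ X) + (k₁ when X s + k₂ when X s)
    add X flow₂ = balance-+ (o₁ X) (k₁ when X t) (i₁ X) (k₁ when X s) (o₂ X) (k₂ when X t) (i₂ X) (k₂ when X s)
                            (cut-balance flow₁ X) (cut-balance flow₂ X)
    subtract : ∀ X → (o₁ X + o₂ X) + (k₁ when X t + k₂ when X t) ≡ (i₁ X + i₂ X) + (k₁ when X s + k₂ when X s) →
               o₂ X + k₂ when X t ≡ i₂ X + k₂ when X s
    subtract X = balance-∸ (o₁ X) (k₁ when X t) (i₁ X) (k₁ when X s) (o₂ X) (k₂ when X t) (i₂ X) (k₂ when X s)
                           (cut-balance flow₁ X)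

  flow-concat : ∀ {F F₁ F₂ s x t k} → IsDisjointUnion F F₁ F₂ →
                IsFlow G F₁ s x k → IsFlow G F₂ x t k → IsFlow G F s t k
  flow-concat {F} {F₁} {F₂} {s} {x} {t} {k} split flow₁ flow₂ .cut-balance X = begin
    ∣ F ∩ leaving G X ∣ + k when X t
      ≡⟨ cong (_+ k when X t) (∣∣-disjointUnion (disjointUnion-∩ split (leaving G X))) ⟩
    (∣ F₁ ∩ leaving G X ∣ + ∣ F₂ ∩ leaving G X ∣) + k when X t
      ≡⟨ balance-chain (∣ F₁ ∩ leaving G X ∣) (∣ F₁ ∩ entering G X ∣) (k when X s)
                       (∣ F₂ ∩ leaving G X ∣) (k when X t) (∣ F₂ ∩ entering G X ∣) (k when X x)
                       (cut-balance flow₁ X) (cut-balance flow₂ X) ⟩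
    (∣ F₁ ∩ entering G X ∣ + ∣ F₂ ∩ entering G X ∣) + k when X s
      ≡⟨ cong (_+ k when X s) (∣∣-disjointUnion (disjointUnion-∩ split (entering G X))) ⟨
    ∣ F ∩ entering G X ∣ + k when X s ∎

  ∅-flow : ∀ {s t} → IsFlow G ∅ s t 0
  ∅-flow {s} {t} .cut-balance X = cong (sum {nArcs G} (λ _ → 0) +_) (trans (0-when (X t)) (sym (0-when (X s))))

  arc-flow : ∀ a → IsFlow G ⁅ a ⁆ (tail G a) (head G a) 1
  arc-flow a .cut-balance X = begin
    ∣ ⁅ a ⁆ ∩ leaving G X ∣ + 𝟙 (X (head G a))  ≡⟨ cong (_+ 𝟙 (X (head G a))) (∣⁅⁆∩∣ a (leaving G X)) ⟩
    𝟙 (leaving G X a) + 𝟙 (X (head G a))        ≡⟨ crossing (X (tail G a)) (X (head G a)) ⟩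
    𝟙 (entering G X a) + 𝟙 (X (tail G a))       ≡⟨ cong (_+ 𝟙 (X (tail G a))) (∣⁅⁆∩∣ a (entering G X)) ⟨
    ∣ ⁅ a ⁆ ∩ entering G X ∣ + 𝟙 (X (tail G a)) ∎
    where
    crossing : ∀ x y → 𝟙 (x ∧ not y) + 𝟙 y ≡ 𝟙 (y ∧ not x) + 𝟙 x
    crossing true  true  = refl
    crossing true  false = refl
    crossing false true  = refl
    crossing false false = refl

  first-arc-unique : ∀ {a as} → Unique (head G a ∷ map (head G) as) → ¬ a ∈ as
  first-arc-unique (head∉ ∷ _) a∈as = All.lookup head∉ (∈-map⁺ (head G) a∈as) refl

  path-flow : ∀ {s t p} → IsPath G s t p → IsFlow G ⟨ p ⟩ s t 1
  path-flow (nil , _) .cut-balance X = refl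
  path-flow (cons {a = a} {as = as} refl walk , _ ∷ distinct) =
    flow-concat (disjointUnion-∪ separate) (arc-flow a) (path-flow (walk , distinct))
    where
    separate : ∀ b → ⁅ a ⁆ b ≡ true → ⟨ as ⟩ b ≡ false
    separate b b∈⁅a⁆ = subst (λ c → ⟨ as ⟩ c ≡ false) (sym (⁅⁆-elim b∈⁅a⁆))
                               (dec-false (a ∈? as) (first-arc-unique distinct))

  paths⇒flow : ∀ {s t k} (ps : Fin k → List (Arc G)) → (∀ i → IsPath G s t (ps i)) →
               (∀ i j → ¬ i ≡ j → ArcDisjoint {D = G} (ps i) (ps j)) → IsFlow G (⋃ (⟨_⟩ ∘ ps)) s t k
  paths⇒flow {k = zero}  ps paths disjoint = ∅-flow
  paths⇒flow {k = suc k} ps paths disjoint =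
    Equivalence.to (flow-disjointUnion (disjointUnion-∪ separate) (path-flow (paths zero)))
      (paths⇒flow (ps ∘ suc) (paths ∘ suc) (λ i j i≢j → disjoint (suc i) (suc j) (i≢j ∘ suc-injective)))
    where
    separate : ∀ a → ⟨ ps zero ⟩ a ≡ true → ⋃ (⟨_⟩ ∘ ps ∘ suc) a ≡ false
    separate a a∈p₀ = ¬-not λ a∈rest →
      let (j , a∈pⱼ) = ⋃-elim (⟨_⟩ ∘ ps ∘ suc) a a∈rest
      in disjoint zero (suc j) (λ ()) a (⟨⟩-elim a∈p₀) (⟨⟩-elim a∈pⱼ)

  flow-crossing : ∀ {F s t k} → IsFlow G F s t k → ∀ X → X s ≡ true → X t ≡ false →
                  ∣ F ∩ leaving G X ∣ ≡ ∣ F ∩ entering G X ∣ + k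
  flow-crossing {F} {s} {t} {k} flow X Xs Xt = begin
    ∣ F ∩ leaving G X ∣                  ≡⟨ sym (+-identityʳ _) ⟩
    ∣ F ∩ leaving G X ∣ + k when false   ≡⟨ cong (λ b → ∣ F ∩ leaving G X ∣ + k when b) (sym Xt) ⟩
    ∣ F ∩ leaving G X ∣ + k when X t     ≡⟨ cut-balance flow X ⟩
    ∣ F ∩ entering G X ∣ + k when X s    ≡⟨ cong (λ b → ∣ F ∩ entering G X ∣ + k when b) Xs ⟩
    ∣ F ∩ entering G X ∣ + k             ∎

  flow≤crossing : ∀ {F s t k} → IsFlow G F s t k → ∀ X → X s ≡ true → X t ≡ false →
                  k ≤ ∣ F ∩ leaving G X ∣
  flow≤crossing flow X Xs Xt = ≤-trans (m≤n+m _ _) (≤-reflexive (sym (flow-crossing flow X Xs Xt)))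

  residual-cut : ∀ {F s t k} → IsFlow G F s t k → ∀ X →
                 cut (reverseArcSet G F) X + k when X s ≡ cut G X + k when X t
  residual-cut {F} {s} {t} {k} flow X =
    balance-transfer (cut G′ X) (cut G X) (∣ F ∩ leaving G X ∣) (∣ F ∩ entering G X ∣) (k when X t) (k when X s)
                     per-cut (cut-balance flow X)
    where
    G′ = reverseArcSet G F
    per-arc : ∀ a → 𝟙 (leaving G′ X a) + 𝟙 ((F ∩ leaving G X) a)
                  ≡ 𝟙 (leaving G X a) + 𝟙 ((F ∩ entering G X) a)
    per-arc a with F a
    ... | true  = +-comm (𝟙 (entering G X a)) _
    ... | false = refl
    per-cut : cut G′ X + ∣ F ∩ leaving G X ∣ ≡ cut G X + ∣ F ∩ entering G X ∣
    per-cut = ∑-balance (𝟙 ∘ leaving G′ X) (𝟙 ∘ (F ∩ leaving G X)) (𝟙 ∘ leaving G X) (𝟙 ∘ (F ∩ entering G X))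
                        per-arc

  augment : ∀ {F Q s t j k} → IsFlow G F s t k → IsFlow (reverseArcSet G F) Q s t j →
            IsFlow G (F ⊕ Q) s t (j + k)
  augment {F} {Q} {s} {t} {j} {k} flow residual .cut-balance X =
    balance-transfer (∣ (F ⊕ Q) ∩ leaving G X ∣) (∣ (F ⊕ Q) ∩ entering G X ∣) (q-in + f-in) (q-out + f-out)
                     ((j + k) when X s) ((j + k) when X t) per-cut (begin
      (q-in + f-in) + (j + k) when X s          ≡⟨ cong ((q-in + f-in) +_) (when-distrib j k (X s)) ⟩
      (q-in + f-in) + (j when X s + k when X s)   ≡⟨ both-flows ⟨
      (q-out + f-out) + (j when X t + k when X t) ≡⟨ cong ((q-out + f-out) +_) (when-distrib j k (X t)) ⟨
      (q-out + f-out) + (j + k) when X t        ∎)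
    where
    G′ = reverseArcSet G F
    f-out f-in q-out q-in : ℕ
    f-out = ∣ F ∩ leaving G X ∣
    f-in  = ∣ F ∩ entering G X ∣
    q-out = ∣ Q ∩ leaving G′ X ∣
    q-in  = ∣ Q ∩ entering G′ X ∣
    both-flows : (q-out + f-out) + (j when X t + k when X t) ≡ (q-in + f-in) + (j when X s + k when X s)
    both-flows = balance-+ q-out (j when X t) q-in (j when X s) f-out (k when X t) f-in (k when X s)
                           (cut-balance residual X) (cut-balance flow X)
    per-arc : ∀ a → 𝟙 (((F ⊕ Q) ∩ leaving G X) a) + (𝟙 ((Q ∩ entering G′ X) a) + 𝟙 ((F ∩ entering G X) a))
                  ≡ 𝟙 (((F ⊕ Q) ∩ entering G X) a) + (𝟙 ((Q ∩ leaving G′ X) a) + 𝟙 ((F ∩ leaving G X) a))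
    per-arc a with F a | Q a
    ... | true  | true  = +-comm (𝟙 (leaving G X a)) _
    ... | true  | false = +-comm (𝟙 (leaving G X a)) _
    ... | false | true  = x∙yz≈y∙xz (𝟙 (leaving G X a)) _ 0
    ... | false | false = refl
    per-cut : ∣ (F ⊕ Q) ∩ leaving G X ∣ + (q-in + f-in) ≡ ∣ (F ⊕ Q) ∩ entering G X ∣ + (q-out + f-out)
    per-cut = begin
      ∣ (F ⊕ Q) ∩ leaving G X ∣ + (q-in + f-in)
        ≡⟨ cong (∣ (F ⊕ Q) ∩ leaving G X ∣ +_) (∑-distrib-+ (𝟙 ∘ (Q ∩ entering G′ X)) (𝟙 ∘ (F ∩ entering G X))) ⟨
      ∣ (F ⊕ Q) ∩ leaving G X ∣ + sum (λ a → 𝟙 ((Q ∩ entering G′ X) a) + 𝟙 ((F ∩ entering G X) a))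
        ≡⟨ ∑-balance (𝟙 ∘ ((F ⊕ Q) ∩ leaving G X)) (λ a → 𝟙 ((Q ∩ entering G′ X) a) + 𝟙 ((F ∩ entering G X) a))
                     (𝟙 ∘ ((F ⊕ Q) ∩ entering G X)) (λ a → 𝟙 ((Q ∩ leaving G′ X) a) + 𝟙 ((F ∩ leaving G X) a))
                     per-arc ⟩
      ∣ (F ⊕ Q) ∩ entering G X ∣ + sum (λ a → 𝟙 ((Q ∩ leaving G′ X) a) + 𝟙 ((F ∩ leaving G X) a))
        ≡⟨ cong (∣ (F ⊕ Q) ∩ entering G X ∣ +_) (∑-distrib-+ (𝟙 ∘ (Q ∩ leaving G′ X)) (𝟙 ∘ (F ∩ leaving G X))) ⟩
      ∣ (F ⊕ Q) ∩ entering G X ∣ + (q-out + f-out) ∎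

PathWithin : ∀ {n} (G : Digraph n) → ArcSet G → Fin n → Fin n → Set
PathWithin G U s t = Σ[ p ∈ List (Arc G) ] (IsPath G s t p × All (λ a → U a ≡ true) p)

Barrier : ∀ {n} (G : Digraph n) → ArcSet G → Fin n → Fin n → Set
Barrier {n} G U s t = Σ[ X ∈ Subset n ] (X s ≡ true × X t ≡ false × ∣ U ∩ leaving G X ∣ ≡ 0)

module BackwardSearch {n} (G : Digraph n) (U : ArcSet G) (s t : Fin n) where

  ReachesWithin : Subset n → Set
  ReachesWithin R = ∀ x → R x ≡ true →
    Σ[ p ∈ List (Arc G) ] (IsPath G x t p × All (λ a → U a ≡ true) p × All (λ y → R y ≡ true) (x ∷ map (head G) p))

  EntryArc : Subset n → Arc G → Set
  EntryArc R a = U a ≡ true × R (head G a) ≡ true × R (tail G a) ≡ false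

  entryArc? : ∀ R a → Dec (EntryArc R a)
  entryArc? R a = (U a ≟ᵇ true) ×-dec ((R (head G a) ≟ᵇ true) ×-dec (R (tail G a) ≟ᵇ false))

  start : ReachesWithin ⁅ t ⁆
  start x x∈⁅t⁆ with refl ← ⁅⁆-elim {a = t} {b = x} x∈⁅t⁆ = [] , (nil , [] ∷ []) , [] , (x∈⁅t⁆ ∷ [])

  extend : ∀ {R} a → EntryArc R a → ReachesWithin R → ReachesWithin (R ∪ ⁅ tail G a ⁆)
  extend {R} a (Ua , Rh , Rt) reach x x∈R′ with R x in Rx
  ... | true  = let (p , path , inU , inR) = reach x Rx
                in p , path , inU , All.map (∪-introˡ R ⁅ tail G a ⁆) inR
  ... | false with refl ← ⁅⁆-elim {a = tail G a} {b = x} x∈R′ =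
    let (p , (walk , distinct) , inU , inR) = reach (head G a) Rh
    in a ∷ p , (cons refl walk , All.map (outside-R Rt) inR ∷ distinct) , Ua ∷ inU ,
       ∪-introʳ R ⁅ tail G a ⁆ x∈R′ ∷ All.map (∪-introˡ R ⁅ tail G a ⁆) inR
    where
    outside-R : ∀ {x y} → R x ≡ false → R y ≡ true → ¬ x ≡ y
    outside-R Rx Ry refl with () ← trans (sym Rx) Ry

  no-entry : ∀ R → ¬ ∃ (EntryArc R) → ∣ U ∩ leaving G (∁ R) ∣ ≡ 0
  no-entry R none = ∑-zero (𝟙 ∘ (U ∩ leaving G (∁ R))) per-arc
    where
    per-arc : ∀ a → 𝟙 ((U ∩ leaving G (∁ R)) a) ≡ 0
    per-arc a with U a in Ua | R (tail G a) in Rt | R (head G a) in Rh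
    ... | true  | false | true  = ⊥-elim (none (a , Ua , Rh , Rt))
    ... | true  | false | false = refl
    ... | true  | true  | _     = refl
    ... | false | _     | _     = refl

  -- Grow R by entering arcs until it contains s or has none; fuel bounds ∣ ∁ R ∣.
  search : ∀ fuel R → ∣ ∁ R ∣ < fuel → R t ≡ true → ReachesWithin R → PathWithin G U s t ⊎ Barrier G U s t
  search (suc fuel) R bound Rt reach with R s in Rs
  ... | true = let (p , path , inU , _) = reach s Rs in inj₁ (p , path , inU)
  ... | false with any? (entryArc? R)
  ...   | no none = inj₂ (∁ R , cong not Rs , cong not Rt , no-entry R none)
  ...   | yes (a , entry) = search fuel (R ∪ ⁅ tail G a ⁆) shrinks (∪-introˡ R ⁅ tail G a ⁆ Rt) (extend a entry reach)
    where
    shrinks : ∣ ∁ (R ∪ ⁅ tail G a ⁆) ∣ < fuel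
    shrinks = <-≤-trans (∣∁∪∣< R ⁅ tail G a ⁆ (proj₂ (proj₂ entry)) (dec-true (tail G a ≟ tail G a) refl))
                        (≤-pred bound)

  result : PathWithin G U s t ⊎ Barrier G U s t
  result = search (suc ∣ ∁ ⁅ t ⁆ ∣) ⁅ t ⁆ ≤-refl (dec-true (t ≟ t) refl) start

path-or-barrier : ∀ {n} (G : Digraph n) (U : ArcSet G) (s t : Fin n) → PathWithin G U s t ⊎ Barrier G U s t
path-or-barrier = BackwardSearch.result

module _ {n : ℕ} (G : Digraph n) where

  DisjointPathsWithin : ArcSet G → Fin n → Fin n → ℕ → Set
  DisjointPathsWithin F s t k = Σ[ sys ∈ HasDisjointPaths G s t k ] (∀ i → All (λ a → F a ≡ true) (proj₁ sys i))

  add-path : ∀ {F s t k q} → IsPath G s t q → All (λ a → F a ≡ true) q →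
             DisjointPathsWithin (F ∖ ⟨ q ⟩) s t k → DisjointPathsWithin F s t (suc k)
  add-path {F} {s} {t} {k} {q} q-path q⊆F ((ps , paths , disjoint) , ps⊆F∖q) = (qps , qpaths , qdisjoint) , within
    where
    qps : Fin (suc k) → List (Arc G)
    qps zero    = q
    qps (suc i) = ps i
    qpaths : ∀ i → IsPath G s t (qps i)
    qpaths zero    = q-path
    qpaths (suc i) = paths i
    avoids-q : ∀ i a → a ∈ ps i → ¬ a ∈ q
    avoids-q i a a∈pᵢ a∈q with () ← trans (sym (dec-true (a ∈? q) a∈q))
                                         (proj₂ (∖-elim F ⟨ q ⟩ (All.lookup (ps⊆F∖q i) a∈pᵢ)))
    qdisjoint : ∀ i j → ¬ i ≡ j → ArcDisjoint {D = G} (qps i) (qps j)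
    qdisjoint zero    zero    0≢0 = ⊥-elim (0≢0 refl)
    qdisjoint zero    (suc j) _   a a∈q a∈pⱼ = avoids-q j a a∈pⱼ a∈q
    qdisjoint (suc i) zero    _   a a∈pᵢ a∈q = avoids-q i a a∈pᵢ a∈q
    qdisjoint (suc i) (suc j) i≢j = disjoint i j (i≢j ∘ cong suc)
    within : ∀ i → All (λ a → F a ≡ true) (qps i)
    within zero    = q⊆F
    within (suc i) = All.map (λ e → proj₁ (∖-elim F ⟨ q ⟩ e)) (ps⊆F∖q i)

  flow⇒paths : ∀ {F s t} k → IsFlow G F s t k → DisjointPathsWithin F s t k
  flow⇒paths zero _ = ((λ ()) , (λ ()) , (λ ())) , (λ ())
  flow⇒paths {F} {s} {t} (suc k) flow with path-or-barrier G F s t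
  ... | inj₂ (X , Xs , Xt , none-leave) with () ← subst (suc k ≤_) none-leave (flow≤crossing G flow X Xs Xt)
  ... | inj₁ (q , q-path , q⊆F) = add-path q-path q⊆F (flow⇒paths k rest)
    where
    rest : IsFlow G (F ∖ ⟨ q ⟩) s t k
    rest = Equivalence.from (flow-disjointUnion G (disjointUnion-∖ (λ a e → All.lookup q⊆F (⟨⟩-elim e)))
                                                   (path-flow G q-path)) flow

  paths≤cut : ∀ {s t k} → HasDisjointPaths G s t k → ∀ X → X s ≡ true → X t ≡ false → k ≤ cut G X
  paths≤cut (ps , paths , disjoint) X Xs Xt =
    ≤-trans (flow≤crossing G (paths⇒flow G ps paths disjoint) X Xs Xt) (∣∩∣≤ (⋃ (⟨_⟩ ∘ ps)) (leaving G X))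

  -- A flow of value k that admits no k + 1 disjoint paths has a cut of size k:
  -- an s–t path in the residual graph would augment it.
  maximal-flow⇒cut : ∀ {F s t k} → IsFlow G F s t k → ¬ HasDisjointPaths G s t (suc k) →
                     Σ[ X ∈ Subset n ] (X s ≡ true × X t ≡ false × cut G X ≡ k)
  maximal-flow⇒cut {F} {s} {t} {k} flow maximal with path-or-barrier (reverseArcSet G F) full s t
  ... | inj₁ (q , q-path , _) =
    ⊥-elim (maximal (proj₁ (flow⇒paths (suc k) (augment G flow (path-flow (reverseArcSet G F) q-path)))))
  ... | inj₂ (X , Xs , Xt , residual-closed) = X , Xs , Xt , (begin
    cut G X                                 ≡⟨ +-identityʳ (cut G X) ⟨
    cut G X + k when false                  ≡⟨ cong (λ b → cut G X + k when b) Xt ⟨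
    cut G X + k when X t                    ≡⟨ residual-cut G flow X ⟨
    cut (reverseArcSet G F) X + k when X s  ≡⟨ cong₂ (λ c b → c + k when b) residual-closed Xs ⟩
    k                                       ∎)

  min-cut : ∀ {s t k} → IsLambda G s t k → Σ[ X ∈ Subset n ] (X s ≡ true × X t ≡ false × cut G X ≡ k)
  min-cut ((ps , paths , disjoint) , maximal) = maximal-flow⇒cut (paths⇒flow G ps paths disjoint) maximal

module _ {n : ℕ} (D : Digraph n) {u v : Fin n} {P : List (Arc D)} (path : IsPath D u v P) where

  private
    D′ = reverseArcs D P

  leaving-reverseArcs : ∀ X a → leaving D′ X a ≡ leaving (reverseArcSet D ⟨ P ⟩) X a
  leaving-reverseArcs X a with a ∈? P
  ... | yes _ = refl
  ... | no  _ = refl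

  reversal-cut : ∀ X → cut D′ X + 𝟙 (X u) ≡ cut D X + 𝟙 (X v)
  reversal-cut X = trans (cong (_+ 𝟙 (X u)) (sum-cong-≗ (cong 𝟙 ∘ leaving-reverseArcs X)))
                         (residual-cut D (path-flow D path) X)

  reversal-cut-separating : ∀ X → X u ≡ true → X v ≡ false → cut D X ≡ suc (cut D′ X)
  reversal-cut-separating X Xu Xv = begin
    cut D X                ≡⟨ +-identityʳ (cut D X) ⟨
    cut D X + 𝟙 false      ≡⟨ cong (λ b → cut D X + 𝟙 b) Xv ⟨
    cut D X + 𝟙 (X v)      ≡⟨ reversal-cut X ⟨
    cut D′ X + 𝟙 (X u)     ≡⟨ cong (λ b → cut D′ X + 𝟙 b) Xu ⟩
    cut D′ X + 1           ≡⟨ +-comm (cut D′ X) 1 ⟩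
    suc (cut D′ X)         ∎

  reversal-cut-other : ∀ X → ¬ (X u ≡ true × X v ≡ false) → cut D X ≤ cut D′ X
  reversal-cut-other X not-separating with X u | X v | reversal-cut X
  ... | true  | false | _ = ⊥-elim (not-separating (refl , refl))
  ... | true  | true  | e = ≤-reflexive (+-cancelʳ-≡ 1 (cut D X) (cut D′ X) (sym e))
  ... | false | false | e = ≤-reflexive (+-cancelʳ-≡ 0 (cut D X) (cut D′ X) (sym e))
  ... | false | true  | e = ≤-trans (m≤m+n (cut D X) 1) (≤-reflexive (trans (sym e) (+-identityʳ (cut D′ X))))

  reversal-lower-bound : ∀ {u′ v′ l l′} → IsLambda D u v l → IsLambda D u′ v′ l′ →
                         ∀ X → X u′ ≡ true → X v′ ≡ false → (l ∸ 1) ⊓ l′ ≤ cut D′ X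
  reversal-lower-bound {l = l} {l′} (uv-paths , _) (u′v′-paths , _) X Xu′ Xv′
    with (X u ≟ᵇ true) ×-dec (X v ≟ᵇ false)
  ... | yes (Xu , Xv) = ≤-trans (m⊓n≤m (l ∸ 1) l′)
          (≤-trans (∸-monoˡ-≤ 1 (paths≤cut D uv-paths X Xu Xv))
                   (≤-reflexive (cong (_∸ 1) (reversal-cut-separating X Xu Xv))))
  ... | no not-separating = ≤-trans (m⊓n≤n (l ∸ 1) l′)
          (≤-trans (paths≤cut D u′v′-paths X Xu′ Xv′) (reversal-cut-other X not-separating))

lemma4 : ∀ {n} (D : Digraph n) (u v : Fin n) (P : List (Arc D)) → IsPath D u v P →
    (∀ (u' v' : Fin n) (l l' l'' : ℕ) → IsLambda D u v l → IsLambda D u' v' l' →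
       IsLambda (reverseArcs D P) u' v' l'' → (l ∸ 1) ⊓ l' ≤ l'')
    × (∀ (l l'' : ℕ) → IsLambda D u v l → IsLambda (reverseArcs D P) u v l'' → l'' ≡ l ∸ 1)
lemma4 D u v P path = other-pairs , reversed-pair
  where
  other-pairs : ∀ u′ v′ l l′ l″ → IsLambda D u v l → IsLambda D u′ v′ l′ →
                IsLambda (reverseArcs D P) u′ v′ l″ → (l ∸ 1) ⊓ l′ ≤ l″
  other-pairs u′ v′ l l′ l″ uv u′v′ u′v′-reversed =
    let (X , Xu′ , Xv′ , cut≡l″) = min-cut (reverseArcs D P) u′v′-reversed
    in ≤-trans (reversal-lower-bound D path uv u′v′ X Xu′ Xv′) (≤-reflexive cut≡l″)

  reversed-pair : ∀ l l″ → IsLambda D u v l → IsLambda (reverseArcs D P) u v l″ → l″ ≡ l ∸ 1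
  reversed-pair l l″ uv uv-reversed = ≤-antisym upper lower
    where
    lower : l ∸ 1 ≤ l″
    lower = subst (_≤ l″) (m≤n⇒m⊓n≡m (m∸n≤m l 1)) (other-pairs u v l l l″ uv uv uv-reversed)
    upper : l″ ≤ l ∸ 1
    upper =
      let (X , Xu , Xv , cut≡l) = min-cut D uv
      in ≤-trans (paths≤cut (reverseArcs D P) (proj₁ uv-reversed) X Xu Xv)
                 (≤-reflexive (cong (_∸ 1) (trans (sym (reversal-cut-separating D path X Xu Xv)) cut≡l)))
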